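{- Let $T_{n+1}$ be a tree of order $n+1>1$. Then $\sigma^{ - }(T_{n+1}) \leq \left\lceil \frac{n}{2}\right\rceil$.
   Context: All graphs are simple. For a connected graph $G$ of order $p$, a parity labelling is a bijection $f:V(G)\to\{1,2,\ldots,p\}$; an edge $uv$ is negative if $f(u)$ and $f(v)$ have opposite parity and positive otherwise (this defines a parity signature of $G$). The rna number $\sigma^{ - }(G)$ is the minimum, over all such bijections $f$, of the number of negative edges. -}

module Defs where

open import Data.Nat using (ℕ; suc; _≤_; _<_; _%_; _<ᵇ_)
open import Data.Fin using (Fin; toℕ)
open import Data.Bool using (Bool; true; false; if_then_else_; _∧_; not)
open import Data.List using (List; []; _∷_; map; allFin; length)
open import Data.Nat.ListAction using (sum)
open import Data.List.Relation.Unary.Unique.Propositional using (Unique)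
open import Data.Product using (Σ; ∃; _×_; _,_)
open import Relation.Nullary using (¬_)
open import Relation.Binary.PropositionalEquality using (_≡_)
open import Function.Bundles using (_⤖_; Bijection)

record Graph (p : ℕ) : Set where
  field
    adj     : Fin p → Fin p → Bool
    adj-sym : ∀ u v → adj u v ≡ adj v u
    loopless : ∀ v → adj v v ≡ false
open Graph public

Adj : ∀ {p} → Graph p → Fin p → Fin p → Set
Adj G u v = adj G u v ≡ true

data Walk {p} (G : Graph p) : Fin p → Fin p → Set where
  nil  : ∀ {u} → Walk G u u
  cons : ∀ {u w v} → Adj G u w → Walk G w v → Walk G u v

Connected : ∀ {p} → Graph p → Set
Connected {p} G = ∀ (u v : Fin p) → Walk G u v

IsWalkList : ∀ {p} → Graph p → List (Fin p) → Set
IsWalkList G [] = Data.Unit.⊤ where import Data.Unit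
IsWalkList G (x ∷ []) = Data.Unit.⊤ where import Data.Unit
IsWalkList G (x ∷ y ∷ xs) = Adj G x y × IsWalkList G (y ∷ xs)

lastOr : ∀ {A : Set} → A → List A → A
lastOr d [] = d
lastOr d (x ∷ xs) = lastOr x xs

IsCycle : ∀ {p} → Graph p → List (Fin p) → Set
IsCycle G [] = Data.Empty.⊥ where import Data.Empty
IsCycle G (v₀ ∷ vs) =
  (3 ≤ length (v₀ ∷ vs)) × Unique (v₀ ∷ vs) × IsWalkList G (v₀ ∷ vs)
  × Adj G (lastOr v₀ vs) v₀

Acyclic : ∀ {p} → Graph p → Set
Acyclic {p} G = ¬ (Σ (List (Fin p)) (IsCycle G))

IsTree : ∀ {p} → Graph p → Set
IsTree G = Connected G × Acyclic G

-- a parity labelling: a bijection V(G) → {1,…,p}; vertex v gets label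
-- suc (toℕ (f v)).
label : ∀ {p} → (Fin p ⤖ Fin p) → Fin p → ℕ
label f v = suc (toℕ (Bijection.to f v))

oppositeParity : ℕ → ℕ → Bool
oppositeParity a b = not (Data.Nat._≡ᵇ_ (a % 2) (b % 2)) where import Data.Nat

-- number of negative edges: unordered pairs {u,v} (counted once, via toℕ u < toℕ v)
-- that are edges and whose labels have opposite parity.
negativeEdges : ∀ {p} → Graph p → (Fin p ⤖ Fin p) → ℕ
negativeEdges {p} G f =
  sum (map (λ u → sum (map (λ v →
    if (toℕ u <ᵇ toℕ v) ∧ adj G u v ∧ oppositeParity (label f u) (label f v)
    then 1 else 0) (allFin p))) (allFin p))

-- σ⁻(G) ≤ k  (the minimum over parity labellings is at most k)
rnaAtMost : ∀ {p} → Graph p → ℕ → Set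
rnaAtMost {p} G k = ∃ λ (f : Fin p ⤖ Fin p) → negativeEdges G f ≤ k

module Submission where

-- An acyclic graph has a
-- vertex with at most one neighbour (an end of a maximal path).  Remove such a leaf ℓ₁,
-- then a leaf ℓ₂ of what remains, list the rest recursively, and put ℓ₁ and ℓ₂ in front,
-- in the order that gives ℓ₂ the label parity of its only later neighbour: the labels 1
-- and 2 have different parities, and the later labels only shift by 2.  Then just the
-- edge from ℓ₁ to a later vertex can be negative, so every pair adds at most one negative
-- edge, and the total is at most ⌊ (n + 1) / 2 ⌋ = ⌈ n / 2 ⌉.

open import Defs
open import Algebra.Properties.CommutativeSemigroup using (interchange)
open import Data.Bool using (Bool; true; false; _∧_; not; if_then_else_; T)
open import Data.Fin as Fin using (Fin; toℕ; fromℕ<; cast)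
open import Data.Fin.Properties using (toℕ-fromℕ<; toℕ-injective; toℕ-cast)
open import Data.List using (List; []; _∷_; _++_; map; length; take; allFin; lookup)
open import Data.List.Properties using (map-cong-local; length-tabulate)
open import Data.List.Membership.Propositional using (_∈_; _∉_)
open import Data.List.Membership.Propositional.Properties using (∈-∃++; ∈-allFin; ∈-lookup)
open import Data.List.Relation.Unary.All as All using (All; []; _∷_)
open import Data.List.Relation.Unary.All.Properties using (¬Any⇒All¬)
open import Data.List.Relation.Unary.AllPairs using (AllPairs; []; _∷_)
open import Data.List.Relation.Unary.AllPairs.Properties using (tabulate⁺-<)
open import Data.List.Relation.Unary.Any using (here; there; index; tail)
open import Data.List.Relation.Unary.Unique.Propositional using (Unique)
open import Data.List.Relation.Unary.Unique.Propositional.Properties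
  using (allFin⁺; take⁺; drop⁺)
open import Data.List.Relation.Binary.Permutation.Propositional as ↭
  using (_↭_; ↭-refl; ↭-sym; ↭-trans; ↭-prep; ↭-swap; ↭⇒↭ₛ)
open import Data.List.Relation.Binary.Permutation.Propositional.Properties
  using (shift; ∈-resp-↭; ↭-length; map⁺)
import Data.List.Relation.Binary.Permutation.Setoid.Properties as ↭ₛ
open import Data.Nat using (ℕ; zero; suc; _+_; _≤_; _<_; _≤?_; _≟_; _%_; _≡ᵇ_; _<ᵇ_;
  z≤n; s≤s; s≤s⁻¹; ⌊_/2⌋; ⌈_/2⌉)
open import Data.Nat.ListAction using (sum)
open import Data.Nat.ListAction.Properties using (sum-↭)
open import Data.Nat.Properties
  using (≤-refl; ≤-trans; <⇒≤; <⇒≱; ≰⇒>; <ᵇ⇒<; <⇒<ᵇ; +-suc; +-identityʳ; +-mono-≤; +-monoˡ-≤;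
         m≤n+m; n≤0⇒n≡0; n<1+n; suc-injective; +-commutativeSemigroup; module ≤-Reasoning)
open import Data.Product using (Σ; ∃; ∃₂; _×_; _,_)
open import Data.Unit using (tt)
open import Function.Bundles using (_⤖_; mk⤖; Bijection)
open import Relation.Binary.Definitions using (DecidableEquality)
open import Relation.Binary.PropositionalEquality
open import Relation.Nullary using (yes; no; contradiction)

𝟙 : Bool → ℕ
𝟙 b = if b then 1 else 0

𝟙-∧ˡ : ∀ a b → 𝟙 (a ∧ b) ≤ 𝟙 a
𝟙-∧ˡ false _ = z≤n
𝟙-∧ˡ true false = z≤n
𝟙-∧ˡ true true = ≤-refl

≡ᵇ-sym : ∀ m n → (m ≡ᵇ n) ≡ (n ≡ᵇ m)
≡ᵇ-sym zero zero = refl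
≡ᵇ-sym zero (suc n) = refl
≡ᵇ-sym (suc m) zero = refl
≡ᵇ-sym (suc m) (suc n) = ≡ᵇ-sym m n

<ᵇ-false : ∀ {m n} → n ≤ m → (m <ᵇ n) ≡ false
<ᵇ-false {m} {n} n≤m with m <ᵇ n in eq
... | false = refl
... | true = contradiction n≤m (<⇒≱ (<ᵇ⇒< m n (subst T (sym eq) tt)))

<ᵇ-true : ∀ {m n} → m < n → (m <ᵇ n) ≡ true
<ᵇ-true {m} {n} m<n with m <ᵇ n in eq
... | true = refl
... | false = contradiction (<⇒<ᵇ m<n) (subst T eq)

+≤1⇒right≡0 : ∀ {a b} → a + b ≤ 1 → a ≢ 0 → b ≡ 0
+≤1⇒right≡0 {zero} _ a≢0 = contradiction refl a≢0
+≤1⇒right≡0 {suc a} {b} (s≤s a+b≤0) _ = n≤0⇒n≡0 (≤-trans (m≤n+m b a) a+b≤0)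

oppositeParity-sym : ∀ a b → oppositeParity a b ≡ oppositeParity b a
oppositeParity-sym a b = cong not (≡ᵇ-sym (a % 2) (b % 2))

oppositeParity-1+2 : ∀ b m → 𝟙 (b ∧ oppositeParity 1 m) + 𝟙 (b ∧ oppositeParity 2 m) ≡ 𝟙 b
oppositeParity-1+2 false _ = refl
oppositeParity-1+2 true 0 = refl
oppositeParity-1+2 true 1 = refl
-- (2 + m) % 2 computes to m % 2
oppositeParity-1+2 true (suc (suc m)) = oppositeParity-1+2 true m

module _ {A : Set} where

  sum-map-cong : ∀ {f g : A → ℕ} {xs} → All (λ x → f x ≡ g x) xs → sum (map f xs) ≡ sum (map g xs)
  sum-map-cong eqs = cong sum (map-cong-local eqs)

  sum-map-mono : ∀ {f g : A → ℕ} xs → (∀ x → f x ≤ g x) → sum (map f xs) ≤ sum (map g xs)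
  sum-map-mono [] _ = z≤n
  sum-map-mono (x ∷ xs) f≤g = +-mono-≤ (f≤g x) (sum-map-mono xs f≤g)

  sum-map-+ : ∀ (f g : A → ℕ) xs → sum (map f xs) + sum (map g xs) ≡ sum (map (λ x → f x + g x) xs)
  sum-map-+ f g [] = refl
  sum-map-+ f g (x ∷ xs) = begin
    (f x + sum (map f xs)) + (g x + sum (map g xs))
      ≡⟨ interchange +-commutativeSemigroup (f x) _ (g x) _ ⟩
    (f x + g x) + (sum (map f xs) + sum (map g xs))
      ≡⟨ cong ((f x + g x) +_) (sum-map-+ f g xs) ⟩
    (f x + g x) + sum (map (λ x → f x + g x) xs) ∎
    where open ≡-Reasoning

  Unique-↭ : ∀ {xs ys : List A} → xs ↭ ys → Unique xs → Unique ys
  Unique-↭ p = ↭ₛ.Unique-resp-↭ (setoid A) (↭⇒↭ₛ p)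

  remove : ∀ {x : A} {xs} → x ∈ xs → ∃ λ ys → xs ↭ x ∷ ys
  remove x∈xs with as , bs , refl ← ∈-∃++ x∈xs = as ++ bs , shift _ as bs

  Unique⇒length≤ : ∀ {xs ys : List A} → Unique xs → (∀ {x} → x ∈ xs → x ∈ ys) →
    length xs ≤ length ys
  Unique⇒length≤ [] _ = z≤n
  Unique⇒length≤ {x ∷ xs} {ys} (x∉xs ∷ u) xs⊆ys with ys' , ys↭ ← remove (xs⊆ys (here refl)) =
    subst (suc (length xs) ≤_) (sym (↭-length ys↭)) (s≤s (Unique⇒length≤ u xs⊆ys'))
    where
    xs⊆ys' : ∀ {w} → w ∈ xs → w ∈ ys'
    xs⊆ys' w∈xs with ∈-resp-↭ ys↭ (xs⊆ys (there w∈xs))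
    ... | here w≡x = contradiction (sym w≡x) (All.lookup x∉xs w∈xs)
    ... | there w∈ys' = w∈ys'

  lastOr-take-index : ∀ {z} (d : A) xs (z∈xs : z ∈ xs) →
    lastOr d (take (suc (toℕ (index z∈xs))) xs) ≡ z
  lastOr-take-index d (x ∷ xs) (here z≡x) = sym z≡x
  lastOr-take-index d (x ∷ xs) (there z∈xs) = lastOr-take-index x xs z∈xs

  degreeIn : (A → A → Bool) → A → List A → ℕ
  degreeIn E x ys = sum (map (λ y → 𝟙 (E x y)) ys)

  edgesIn : (A → A → Bool) → List A → ℕ
  edgesIn E [] = 0
  edgesIn E (x ∷ xs) = degreeIn E x xs + edgesIn E xs

  degreeIn-↭ : ∀ E x {ys zs} → ys ↭ zs → degreeIn E x ys ≡ degreeIn E x zs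
  degreeIn-↭ E x p = sum-↭ (map⁺ _ p)

  degreeIn-cong : ∀ E E' {x ys} → All (λ y → E x y ≡ E' x y) ys → degreeIn E x ys ≡ degreeIn E' x ys
  degreeIn-cong _ _ eqs = sum-map-cong (All.map (cong 𝟙) eqs)

  degreeIn-∧ˡ : ∀ (E F : A → A → Bool) x ys →
    degreeIn (λ u v → E u v ∧ F u v) x ys ≤ degreeIn E x ys
  degreeIn-∧ˡ E F x ys =
    sum-map-mono {λ y → 𝟙 (E x y ∧ F x y)} {λ y → 𝟙 (E x y)} ys (λ y → 𝟙-∧ˡ (E x y) (F x y))

  degreeIn-pos : ∀ {E x ys} → 0 < degreeIn E x ys → ∃ λ y → y ∈ ys × E x y ≡ true
  degreeIn-pos {E} {x} {y ∷ ys} pos with E x y in e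
  ... | true = y , here refl , e
  ... | false with z , z∈ys , ez ← degreeIn-pos {E} {x} pos = z , there z∈ys , ez

  distinctNeighbours : ∀ {E x ys} → Unique ys → 1 < degreeIn E x ys →
    ∃₂ λ u w → u ∈ ys × w ∈ ys × E x u ≡ true × E x w ≡ true × u ≢ w
  distinctNeighbours {E} {x} {y ∷ ys} (y∉ys ∷ u) d with E x y in e
  ... | true with z , z∈ys , ez ← degreeIn-pos {E} {x} (s≤s⁻¹ d) =
    y , z , here refl , there z∈ys , e , ez , All.lookup y∉ys z∈ys
  ... | false with a , b , a∈ , b∈ , ea , eb , a≢b ← distinctNeighbours {E} {x} u d =
    a , b , there a∈ , there b∈ , ea , eb , a≢b

  neighbourAvoiding : DecidableEquality A → ∀ {E x ys} → Unique ys → 1 < degreeIn E x ys →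
    ∀ y → ∃ λ z → z ∈ ys × E x z ≡ true × z ≢ y
  neighbourAvoiding _≟_ {E} {x} u d y with distinctNeighbours {E} {x} u d
  ... | a , b , a∈ , b∈ , ea , eb , a≢b with a ≟ y
  ... | yes refl = b , b∈ , eb , λ b≡a → a≢b (sym b≡a)
  ... | no a≢y = a , a∈ , ea , a≢y

  edgesIn-↭ : ∀ {E} → (∀ x y → E x y ≡ E y x) → ∀ {xs ys} → xs ↭ ys → edgesIn E xs ≡ edgesIn E ys
  edgesIn-↭ E-sym ↭.refl = refl
  edgesIn-↭ {E} E-sym (↭.prep x p) = cong₂ _+_ (degreeIn-↭ E x p) (edgesIn-↭ E-sym p)
  edgesIn-↭ {E} E-sym (↭.trans p q) = trans (edgesIn-↭ {E} E-sym p) (edgesIn-↭ E-sym q)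
  edgesIn-↭ {E} E-sym {x ∷ y ∷ xs} {y ∷ x ∷ ys} (↭.swap x y p) = begin
    (𝟙 (E x y) + degreeIn E x xs) + (degreeIn E y xs + edgesIn E xs)
      ≡⟨ interchange +-commutativeSemigroup (𝟙 (E x y)) _ _ _ ⟩
    (𝟙 (E x y) + degreeIn E y xs) + (degreeIn E x xs + edgesIn E xs)
      ≡⟨ cong₂ _+_ (cong₂ _+_ (cong 𝟙 (E-sym x y)) (degreeIn-↭ E y p))
                   (cong₂ _+_ (degreeIn-↭ E x p) (edgesIn-↭ E-sym p)) ⟩
    (𝟙 (E y x) + degreeIn E y ys) + (degreeIn E x ys + edgesIn E ys) ∎
    where open ≡-Reasoning

  -- The left-hand side has the shape of negativeEdges, which counts an edge uv once, when
  -- key u < key v.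
  edgesIn-sorted : ∀ (key : A → ℕ) E {xs} → AllPairs (λ u v → key u < key v) xs →
    sum (map (λ u → sum (map (λ v → 𝟙 ((key u <ᵇ key v) ∧ E u v)) xs)) xs) ≡ edgesIn E xs
  edgesIn-sorted key E [] = refl
  edgesIn-sorted key E {x ∷ xs} (x<xs ∷ sorted) = cong₂ _+_ fromHead fromTail
    where
    fromHead : 𝟙 ((key x <ᵇ key x) ∧ E x x) + sum (map (λ v → 𝟙 ((key x <ᵇ key v) ∧ E x v)) xs)
             ≡ degreeIn E x xs
    fromHead = cong₂ _+_ (cong (λ b → 𝟙 (b ∧ E x x)) (<ᵇ-false {key x} ≤-refl))
      (sum-map-cong (All.map (λ {v} x<v → cong (λ b → 𝟙 (b ∧ E x v)) (<ᵇ-true x<v)) x<xs))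
    fromTail : sum (map (λ u → 𝟙 ((key u <ᵇ key x) ∧ E u x)
                             + sum (map (λ v → 𝟙 ((key u <ᵇ key v) ∧ E u v)) xs)) xs)
             ≡ edgesIn E xs
    fromTail = trans
      (sum-map-cong (All.map (λ {u} x<u →
        cong (λ b → 𝟙 (b ∧ E u x) + inner u) (<ᵇ-false (<⇒≤ x<u))) x<xs))
      (edgesIn-sorted key E sorted)
      where
      inner : A → ℕ
      inner u = sum (map (λ v → 𝟙 ((key u <ᵇ key v) ∧ E u v)) xs)

module Positions {A : Set} (_≟_ : DecidableEquality A) where

  position : List A → A → ℕ
  position [] _ = 0
  position (x ∷ xs) y with y ≟ x
  ... | yes _ = 0
  ... | no _ = suc (position xs y)

  position-head : ∀ x xs → position (x ∷ xs) x ≡ 0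
  position-head x xs with x ≟ x
  ... | yes _ = refl
  ... | no x≢x = contradiction refl x≢x

  position-tail : ∀ {x y} xs → x ≢ y → position (x ∷ xs) y ≡ suc (position xs y)
  position-tail {x} {y} xs x≢y with y ≟ x
  ... | yes refl = contradiction refl x≢y
  ... | no _ = refl

  position-∷∷ : ∀ {a b y} xs → a ≢ y → b ≢ y → position (a ∷ b ∷ xs) y ≡ 2 + position xs y
  position-∷∷ {b = b} xs a≢y b≢y =
    trans (position-tail (b ∷ xs) a≢y) (cong suc (position-tail xs b≢y))

  position-< : ∀ {y xs} → y ∈ xs → position xs y < length xs
  position-< {y} {x ∷ xs} y∈ with y ≟ x
  ... | yes _ = s≤s z≤n
  ... | no y≢x = s≤s (position-< (tail y≢x y∈))

  position-injective : ∀ {y z xs} → y ∈ xs → z ∈ xs → position xs y ≡ position xs z → y ≡ z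
  position-injective {y} {z} {x ∷ xs} y∈ z∈ eq with y ≟ x | z ≟ x
  ... | yes refl | yes refl = refl
  ... | yes _ | no _ = contradiction eq λ ()
  ... | no _ | yes _ = contradiction eq λ ()
  ... | no y≢x | no z≢x = position-injective (tail y≢x y∈) (tail z≢x z∈) (suc-injective eq)

  position-lookup : ∀ {xs} → Unique xs → ∀ i → position xs (lookup xs i) ≡ toℕ i
  position-lookup {x ∷ xs} _ Fin.zero = position-head x xs
  position-lookup {x ∷ xs} (x∉xs ∷ u) (Fin.suc i) =
    trans (position-tail xs (All.lookup x∉xs (∈-lookup i))) (cong suc (position-lookup u i))

module FinPositions {n : ℕ} = Positions (Fin._≟_ {n})
open FinPositions

positionBijection : ∀ {p} (R : List (Fin p)) → Unique R → R ↭ allFin p →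
  Σ (Fin p ⤖ Fin p) λ f → ∀ v → toℕ (Bijection.to f v) ≡ position R v
positionBijection {p} R uR R↭ =
  mk⤖ (to-injective , to-surjective) , λ v → toℕ-fromℕ< (position<p v)
  where
  |R|≡p : length R ≡ p
  |R|≡p = trans (↭-length R↭) (length-tabulate (λ i → i))
  member : ∀ v → v ∈ R
  member v = ∈-resp-↭ (↭-sym R↭) (∈-allFin v)
  position<p : ∀ v → position R v < p
  position<p v = subst (position R v <_) |R|≡p (position-< (member v))
  to : Fin p → Fin p
  to v = fromℕ< (position<p v)
  to-injective : ∀ {u v} → to u ≡ to v → u ≡ v
  to-injective {u} {v} eq = position-injective (member u) (member v)
    (trans (sym (toℕ-fromℕ< (position<p u))) (trans (cong toℕ eq) (toℕ-fromℕ< (position<p v))))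
  to-surjective : ∀ y → ∃ λ x → ∀ {z} → z ≡ x → to z ≡ y
  to-surjective y = lookup R i , λ { refl → toℕ-injective (begin
      toℕ (to (lookup R i))   ≡⟨ toℕ-fromℕ< (position<p (lookup R i)) ⟩
      position R (lookup R i) ≡⟨ position-lookup uR i ⟩
      toℕ i                   ≡⟨ toℕ-cast (sym |R|≡p) y ⟩
      toℕ y ∎) }
    where
    open ≡-Reasoning
    i = cast (sym |R|≡p) y

module _ {p : ℕ} (G : Graph p) where

  Adj-sym : ∀ {u v} → Adj G u v → Adj G v u
  Adj-sym {u} {v} e = trans (adj-sym G v u) e

  LeafIn : List (Fin p) → Fin p → Set
  LeafIn S x = degreeIn (adj G) x S ≤ 1

  LeafIn-↭ : ∀ {S S' x} → S ↭ S' → LeafIn S x → LeafIn S' x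
  LeafIn-↭ {x = x} p = subst (_≤ 1) (degreeIn-↭ (adj G) x p)

  IsWalkList-take : ∀ k xs → IsWalkList G xs → IsWalkList G (take k xs)
  IsWalkList-take zero xs _ = tt
  IsWalkList-take (suc k) [] _ = tt
  IsWalkList-take (suc zero) (x ∷ xs) _ = tt
  IsWalkList-take (suc (suc k)) (x ∷ []) _ = tt
  IsWalkList-take (suc (suc k)) (x ∷ y ∷ xs) (xy , w) = xy , IsWalkList-take (suc k) (y ∷ xs) w

  -- the path is stored from its newest vertex x back to its start
  backEdge⇒cycle : ∀ {x y z rest} → Unique (x ∷ y ∷ rest) → IsWalkList G (x ∷ y ∷ rest) →
    z ∈ rest → Adj G x z → Σ (List (Fin p)) (IsCycle G)
  backEdge⇒cycle {x} {y} {z} {r ∷ rs} u w z∈rest xz =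
    x ∷ y ∷ take k (r ∷ rs) ,
    s≤s (s≤s (s≤s z≤n)) ,
    take⁺ (2 + k) u ,
    IsWalkList-take (2 + k) (x ∷ y ∷ r ∷ rs) w ,
    subst (λ v → Adj G v x) (sym (lastOr-take-index y (r ∷ rs) z∈rest)) (Adj-sym xz)
    where k = suc (toℕ (index z∈rest))

  negative : (Fin p → ℕ) → Fin p → Fin p → Bool
  negative lab u v = adj G u v ∧ oppositeParity (lab u) (lab v)

  negative-sym : ∀ lab u v → negative lab u v ≡ negative lab v u
  negative-sym lab u v = cong₂ _∧_ (adj-sym G u v) (oppositeParity-sym (lab u) (lab v))

  edgesIn-negative-cong : ∀ lab lab' {xs} → All (λ v → lab v % 2 ≡ lab' v % 2) xs →
    edgesIn (negative lab) xs ≡ edgesIn (negative lab') xs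
  edgesIn-negative-cong _ _ [] = refl
  edgesIn-negative-cong lab lab' (px ∷ pxs) = cong₂ _+_
    (degreeIn-cong (negative lab) (negative lab')
      (All.map (λ py → cong (adj G _ _ ∧_) (cong₂ (λ a b → not (a ≡ᵇ b)) px py)) pxs))
    (edgesIn-negative-cong lab lab' pxs)

  positionLabel : List (Fin p) → Fin p → ℕ
  positionLabel R v = suc (position R v)

  negativeCount : List (Fin p) → ℕ
  negativeCount R = edgesIn (negative (positionLabel R)) R

  negativeCount-drop2 : ∀ {a b R} → Unique (a ∷ b ∷ R) →
    edgesIn (negative (positionLabel (a ∷ b ∷ R))) R ≡ negativeCount R
  negativeCount-drop2 {a} {b} {R} ((_ ∷ a∉R) ∷ b∉R ∷ _) =
    edgesIn-negative-cong (positionLabel (a ∷ b ∷ R)) (positionLabel R)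
      (All.zipWith (λ (a≢v , b≢v) → cong (λ k → suc k % 2) (position-∷∷ R a≢v b≢v)) (a∉R , b∉R))

  -- the labels 1 and 2 at the front split the neighbours of ℓ₂ in R between the two orders
  degreeIn-frontLabels : ∀ {ℓ₁ ℓ₂ R} → Unique (ℓ₁ ∷ ℓ₂ ∷ R) →
    degreeIn (negative (positionLabel (ℓ₂ ∷ ℓ₁ ∷ R))) ℓ₂ R
      + degreeIn (negative (positionLabel (ℓ₁ ∷ ℓ₂ ∷ R))) ℓ₂ R
    ≡ degreeIn (adj G) ℓ₂ R
  degreeIn-frontLabels {ℓ₁} {ℓ₂} {R} ((ℓ₁≢ℓ₂ ∷ ℓ₁∉R) ∷ ℓ₂∉R ∷ _) =
    trans (sum-map-+ _ _ R) (sum-map-cong (All.zipWith split (ℓ₁∉R , ℓ₂∉R)))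
    where
    split : ∀ {v} → ℓ₁ ≢ v × ℓ₂ ≢ v →
      𝟙 (negative (positionLabel (ℓ₂ ∷ ℓ₁ ∷ R)) ℓ₂ v)
        + 𝟙 (negative (positionLabel (ℓ₁ ∷ ℓ₂ ∷ R)) ℓ₂ v)
      ≡ 𝟙 (adj G ℓ₂ v)
    split {v} (ℓ₁≢v , ℓ₂≢v)
      rewrite position-head ℓ₂ (ℓ₁ ∷ R) | position-tail (ℓ₂ ∷ R) ℓ₁≢ℓ₂ | position-head ℓ₂ R
            | position-∷∷ R ℓ₂≢v ℓ₁≢v | position-∷∷ R ℓ₁≢v ℓ₂≢v
      = oppositeParity-1+2 (adj G ℓ₂ v) (suc (suc (suc (position R v))))

  negativeCount-twoLeaves : ∀ {a b ℓ₁ ℓ₂ R} → Unique (a ∷ b ∷ R) → a ∷ b ∷ R ↭ ℓ₁ ∷ ℓ₂ ∷ R →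
    LeafIn (ℓ₂ ∷ R) ℓ₁ → degreeIn (negative (positionLabel (a ∷ b ∷ R))) ℓ₂ R ≡ 0 →
    negativeCount (a ∷ b ∷ R) ≤ suc (negativeCount R)
  negativeCount-twoLeaves {a} {b} {ℓ₁} {ℓ₂} {R} u p leaf₁ noNegative = begin
    edgesIn E (a ∷ b ∷ R)
      ≡⟨ edgesIn-↭ (negative-sym lab) p ⟩
    degreeIn E ℓ₁ (ℓ₂ ∷ R) + (degreeIn E ℓ₂ R + edgesIn E R)
      ≤⟨ +-monoˡ-≤ _ (≤-trans (degreeIn-∧ˡ (adj G) opposite ℓ₁ (ℓ₂ ∷ R)) leaf₁) ⟩
    suc (degreeIn E ℓ₂ R + edgesIn E R)
      ≡⟨ cong suc (cong₂ _+_ noNegative (negativeCount-drop2 u)) ⟩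
    suc (negativeCount R) ∎
    where
    open ≤-Reasoning
    lab = positionLabel (a ∷ b ∷ R)
    E = negative lab
    opposite = λ u v → oppositeParity (lab u) (lab v)

  prependLeaves : ∀ {ℓ₁ ℓ₂ R} → Unique (ℓ₁ ∷ ℓ₂ ∷ R) → LeafIn (ℓ₂ ∷ R) ℓ₁ → LeafIn R ℓ₂ →
    ∃ λ R' → R' ↭ ℓ₁ ∷ ℓ₂ ∷ R × negativeCount R' ≤ suc (negativeCount R)
  prependLeaves {ℓ₁} {ℓ₂} {R} u leaf₁ leaf₂
    with degreeIn (negative (positionLabel (ℓ₂ ∷ ℓ₁ ∷ R))) ℓ₂ R ≟ 0
  ... | yes none = ℓ₂ ∷ ℓ₁ ∷ R , ↭-swap ℓ₂ ℓ₁ ↭-refl ,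
    negativeCount-twoLeaves (Unique-↭ (↭-swap ℓ₁ ℓ₂ ↭-refl) u) (↭-swap ℓ₂ ℓ₁ ↭-refl) leaf₁ none
  ... | no some = ℓ₁ ∷ ℓ₂ ∷ R , ↭-refl ,
    negativeCount-twoLeaves u ↭-refl leaf₁
      (+≤1⇒right≡0 (subst (_≤ 1) (sym (degreeIn-frontLabels u)) leaf₂) some)

  -- for a one-vertex path x is a dummy: no neighbour of x equals x
  previous : Fin p → List (Fin p) → Fin p
  previous x [] = x
  previous x (y ∷ _) = y

  module _ (acyclic : Acyclic G) where

    freshNeighbour : ∀ {x tl z} → Unique (x ∷ tl) → IsWalkList G (x ∷ tl) →
      Adj G x z → z ≢ previous x tl → z ∉ x ∷ tl
    freshNeighbour {x} _ _ xz _ (here refl) = contradiction (trans (sym xz) (loopless G x)) λ ()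
    freshNeighbour _ _ _ z≢y (there (here z≡y)) = z≢y z≡y
    freshNeighbour u w xz _ (there (there z∈rest)) = acyclic (backEdge⇒cycle u w z∈rest xz)

    leafFrom : ∀ {S} fuel x tl → Unique S → Unique (x ∷ tl) → All (_∈ S) (x ∷ tl) →
      IsWalkList G (x ∷ tl) → length S < length (x ∷ tl) + fuel → ∃ λ ℓ → ℓ ∈ S × LeafIn S ℓ
    leafFrom {S} zero x tl _ u inS _ S<path =
      contradiction (Unique⇒length≤ u (All.lookup inS))
        (<⇒≱ (subst (length S <_) (+-identityʳ _) S<path))
    leafFrom {S} (suc fuel) x tl uS u inS w S<path with degreeIn (adj G) x S ≤? 1
    ... | yes leaf = x , All.head inS , leaf
    ... | no notLeaf
      with z , z∈S , xz , z≢prev ←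
             neighbourAvoiding Fin._≟_ {adj G} {x} uS (≰⇒> notLeaf) (previous x tl) =
      leafFrom fuel z (x ∷ tl) uS (¬Any⇒All¬ _ (freshNeighbour u w xz z≢prev) ∷ u) (z∈S ∷ inS)
        (Adj-sym xz , w) (subst (length S <_) (+-suc _ fuel) S<path)

    peelLeaf : ∀ {S} → Unique S → 0 < length S → ∃₂ λ ℓ S' → S ↭ ℓ ∷ S' × LeafIn S' ℓ
    peelLeaf {s ∷ S} uS _
      with ℓ , ℓ∈S , leaf ←
             leafFrom (length (s ∷ S)) s [] uS ([] ∷ []) (here refl ∷ []) tt (n<1+n _)
      with S' , S↭ ← remove ℓ∈S =
      ℓ , S' , S↭ , ≤-trans (m≤n+m _ _) (LeafIn-↭ S↭ leaf)

    peelTwoLeaves : ∀ {S} → Unique S → 2 ≤ length S →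
      ∃₂ λ ℓ₁ ℓ₂ → ∃ λ S₂ → S ↭ ℓ₁ ∷ ℓ₂ ∷ S₂ × LeafIn (ℓ₂ ∷ S₂) ℓ₁ × LeafIn S₂ ℓ₂
    peelTwoLeaves {S} uS 2≤|S| with ℓ₁ , S₁ , S↭ , leaf₁ ← peelLeaf uS (<⇒≤ 2≤|S|)
      with ℓ₂ , S₂ , S₁↭ , leaf₂ ←
             peelLeaf (drop⁺ 1 (Unique-↭ S↭ uS)) (s≤s⁻¹ (subst (2 ≤_) (↭-length S↭) 2≤|S|)) =
      ℓ₁ , ℓ₂ , S₂ , ↭-trans S↭ (↭-prep ℓ₁ S₁↭) , LeafIn-↭ S₁↭ leaf₁ , leaf₂

    arrangement : ∀ n S → length S ≡ n → Unique S →
      ∃ λ R → R ↭ S × negativeCount R ≤ ⌊ n /2⌋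
    arrangement zero [] _ _ = [] , ↭-refl , z≤n
    arrangement (suc zero) (x ∷ []) _ _ = x ∷ [] , ↭-refl , z≤n
    arrangement (suc (suc n)) S |S| uS =
      let ℓ₁ , ℓ₂ , S₂ , S↭ , leaf₁ , leaf₂ =
            peelTwoLeaves uS (subst (2 ≤_) (sym |S|) (s≤s (s≤s z≤n)))
          u = Unique-↭ S↭ uS
          R₂ , R₂↭S₂ , bound = arrangement n S₂
            (suc-injective (suc-injective (trans (sym (↭-length S↭)) |S|))) (drop⁺ 2 u)
          S₂↭R₂ = ↭-sym R₂↭S₂
          R , R↭ , count≤ = prependLeaves (Unique-↭ (↭-prep ℓ₁ (↭-prep ℓ₂ S₂↭R₂)) u)
            (LeafIn-↭ (↭-prep ℓ₂ S₂↭R₂) leaf₁) (LeafIn-↭ S₂↭R₂ leaf₂)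
      in R , ↭-trans R↭ (↭-trans (↭-prep ℓ₁ (↭-prep ℓ₂ R₂↭S₂)) (↭-sym S↭)) ,
         ≤-trans count≤ (s≤s bound)

mainTheorem1 : (n : ℕ) → 1 ≤ n → (T : Graph (suc n)) → IsTree T →
    rnaAtMost T ⌈ n /2⌉
mainTheorem1 n _ T (_ , acyclic) =
  let R , R↭ , count≤ = arrangement T acyclic (suc n) (allFin (suc n))
                          (length-tabulate (λ i → i)) (allFin⁺ (suc n))
      f , f≡position = positionBijection R (Unique-↭ (↭-sym R↭) (allFin⁺ (suc n))) R↭
  in f , (begin
    negativeEdges T f
      ≡⟨ edgesIn-sorted toℕ (negative T (label f)) (tabulate⁺-< (λ i<j → i<j)) ⟩
    edgesIn (negative T (label f)) (allFin (suc n))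
      ≡⟨ edgesIn-↭ (negative-sym T (label f)) (↭-sym R↭) ⟩
    edgesIn (negative T (label f)) R
      ≡⟨ edgesIn-negative-cong T (label f) (positionLabel T R) {R}
           (All.tabulate (λ {v} _ → cong (λ k → suc k % 2) (f≡position v))) ⟩
    negativeCount T R
      ≤⟨ count≤ ⟩
    ⌈ n /2⌉ ∎)
  where open ≤-Reasoning
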